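{- Let $t>1$ be odd, $1\le i\le 4t$ and $2\le n\le 4t$, with all indices of generalized coboundary matrices read modulo $4t$ with representatives in $\{1,\dots,4t\}$. Then the generalized coboundary matrix $N_j$ has a $-1$ entry in row $n$ in a common position with $N_i$, where: (1) if $n\equiv1\pmod 4$, $j=i-n+1$; (2) if $n\equiv2\pmod 4$, $j=i-n+2-(-1)^i$; (3) if $n\equiv3\pmod 4$, $j=i-n+3-2(-1)^{\lceil (i \bmod 4)/2\rceil}$; (4) if $n\equiv0\pmod 4$, $j=i-n+4+(-1)^i\big(1-4(1-\lfloor (i\bmod 4)/2\rfloor)\big)$. (Here $i\bmod 4\in\{0,1,2,3\}$.)
   Context: $G=\mathbb{Z}_t\times\mathbb{Z}_2^2=\langle x,u,v\mid x^t=u^2=v^2=1,\ uv=vu\rangle$, with elements ordered $g_{4m+1}=x^m$, $g_{4m+2}=x^mu$, $g_{4m+3}=x^mv$, $g_{4m+4}=x^muv$ for $0\le m\le t-1$. For $1\le i\le 4t$ let $\delta_i:G\to\{\pm1\}$ with $\delta_i(g)=-1$ iff $g=g_i$. The generalized coboundary matrix $N_i$ is the $4t\times4t$ matrix with $(s,j)$ entry $\delta_i(g_j)\delta_i(g_sg_j)$; for $s\ge2$ its row $s$ has $-1$ exactly in columns $i$ and $e$ where $g_e=g_s^{ -1}g_i$. In the paper's terminology, $N_j$ "forms an $n$-path with" $N_i$. -}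

module Defs where

open import Data.Nat as ℕ using (ℕ; zero; suc; _∸_; NonZero; _/_; _%_)
open import Data.Nat.Properties using (m*n≢0)
open import Data.Bool using (Bool; true; false; _xor_; if_then_else_)
open import Data.Bool.Properties using () renaming (_≟_ to _≟ᵇ_)
open import Data.Product using (_×_; _,_)
open import Data.Integer as ℤ using (ℤ; +_; -1ℤ; 1ℤ; _%ℕ_)
open import Relation.Nullary using (does)
open import Relation.Nullary.Decidable using (_×-dec_)

-- Elements of G = Z_t × Z_2 × Z_2, written x^m u^a v^b as (m , a , b)
-- with 0 ≤ m < t.
G : Set
G = ℕ × Bool × Bool

module _ (t : ℕ) .{{_ : NonZero t}} where

  _·_ : G → G → G
  (m , a , b) · (m' , a' , b') = ((m ℕ.+ m') % t , a xor a' , b xor b')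

  -- the ordering: g_{4m+1} = x^m, g_{4m+2} = x^m u, g_{4m+3} = x^m v,
  -- g_{4m+4} = x^m uv   (index j is 1-based; for j in 1..4t)
  bitU : ℕ → Bool
  bitU 1 = true
  bitU 3 = true
  bitU _ = false

  bitV : ℕ → Bool
  bitV 2 = true
  bitV 3 = true
  bitV _ = false

  g : ℕ → G
  g j = (((j ∸ 1) / 4) % t , bitU ((j ∸ 1) % 4) , bitV ((j ∸ 1) % 4))

  δ : ℕ → G → ℤ
  δ i (m , a , b) with g i
  ... | (m' , a' , b') =
    if does ((m ℕ.≟ m') ×-dec ((a ≟ᵇ a') ×-dec (b ≟ᵇ b'))) then -1ℤ else 1ℤ

  N : ℕ → ℕ → ℕ → ℤ
  N i s c = δ i (g c) ℤ.* δ i (g s · g c)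

  rep : ℤ → ℕ
  rep z = suc (_%ℕ_ (z ℤ.- 1ℤ) (4 ℕ.* t) {{m*n≢0 4 t}})

  sgn : ℕ → ℤ
  sgn k = -1ℤ ℤ.^ k

  jRawCase : ℕ → ℕ → ℕ → ℤ
  jRawCase 1 i n = + i ℤ.- + n ℤ.+ + 1
  jRawCase 2 i n = + i ℤ.- + n ℤ.+ + 2 ℤ.- sgn i
  jRawCase 3 i n = + i ℤ.- + n ℤ.+ + 3 ℤ.- + 2 ℤ.* sgn ((i % 4 ℕ.+ 1) / 2)
      -- ⌈(i mod 4)/2⌉ = ((i mod 4) + 1) / 2
  jRawCase _ i n = + i ℤ.- + n ℤ.+ + 4
      ℤ.+ sgn i ℤ.* (+ 1 ℤ.- + 4 ℤ.* (+ 1 ℤ.- + ((i % 4) / 2)))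

  jIdx : ℕ → ℕ → ℕ
  jIdx i n = rep (jRawCase (n % 4) i n)

-- Row n ≥ 2 of N_i has −1 exactly in columns i and c with g_n g_c = g_i (these
-- differ because g_n ≠ 1).  So if g_j = g_n⁻¹ g_i, column j carries a −1 in row n
-- of N_i and, being its diagonal column, also in row n of N_j.  It remains to see
-- that the paper's j is the index of g_n⁻¹ g_i.  Writing i = 1 + p + 4a and
-- n = 1 + q + 4b with p, q < 4, the residues p, q are the bit pairs of the Z₂²
-- components, so g_n⁻¹ g_i has index 1 + (p xor q) + 4((a − b) mod t).  The
-- formulas depend on i only through (−1)^i and i mod 4, hence shifting i and n by
-- multiples of 4 shifts j by 4(a − b), and on 1 ≤ i, n ≤ 4 they are a 16-entry table.

module Submission where

open import Defs
open import Data.Nat as ℕ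
  using (ℕ; NonZero; zero; suc; _≤_; _<_; _*_; _∸_; s≤s; z≤n)
open import Data.Nat.Properties as ℕ
  using (≮⇒≥; <⇒≤; m<n⇒0<n∸m; m∸[m∸n]≡n; ∸-monoʳ-<; m+[n∸m]≡n; m∸n+n≡m; +-cancelʳ-≡; m*n≢0)
open import Data.Nat.DivMod
open import Data.Nat.Divisibility using (divides-refl)
open import Data.Integer as ℤ using (ℤ; +_; -1ℤ; 1ℤ; _%ℕ_)
open import Data.Integer.DivMod using (n%ℕd<d)
open import Data.Integer.Properties as ℤ
  using (m-n≡m⊖n; ⊖-≥; ⊖-<; pos-+; ^-distribˡ-+-*; ^-*-assoc; ^-zeroˡ)
open import Data.Integer.Tactic.RingSolver using (solve-∀)
import Data.Nat.Tactic.RingSolver as ℕ-Ring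
open import Data.Bool using (Bool; true; false; _xor_; if_then_else_)
open import Data.Bool.Properties using () renaming (_≟_ to _≟ᵇ_)
open import Data.Product using (_×_; _,_; proj₁; proj₂; ∃-syntax)
open import Relation.Nullary using (Dec; yes; no)
open import Relation.Nullary.Decidable using (dec-true; dec-false; _×-dec_)
open import Relation.Binary.PropositionalEquality
open import Function using (_∘_)

-[n]%ℕn≡0 : ∀ n .{{_ : NonZero n}} → (ℤ.- + n) %ℕ n ≡ 0
-[n]%ℕn≡0 n@(suc _) rewrite n%n≡0 n {{_}} = refl

-[m]%ℕn≡n∸m : ∀ {m n} .{{_ : NonZero n}} → 0 < m → m < n → (ℤ.- + m) %ℕ n ≡ n ∸ m
-[m]%ℕn≡n∸m {suc m} _ m<n rewrite m<n⇒m%n≡m m<n = refl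

[m-n]%ℕn≡m%n : ∀ m n .{{_ : NonZero n}} → (+ m ℤ.- + n) %ℕ n ≡ m % n
[m-n]%ℕn≡m%n m n with m ℕ.<? n
... | no m≮n = trans (cong (_%ℕ n) (trans (m-n≡m⊖n m n) (⊖-≥ (≮⇒≥ m≮n))))
                     (m≤n⇒[n∸m]%m≡n%m (≮⇒≥ m≮n))
... | yes m<n = trans (cong (_%ℕ n) (trans (m-n≡m⊖n m n) (⊖-< m<n))) (negative m m<n)
  where
  negative : ∀ m → m < n → (ℤ.- + (n ∸ m)) %ℕ n ≡ m % n
  negative zero 0<n = trans (-[n]%ℕn≡0 n) (sym (m<n⇒m%n≡m 0<n))
  negative m@(suc _) m<n = begin
    (ℤ.- + (n ∸ m)) %ℕ n ≡⟨ -[m]%ℕn≡n∸m (m<n⇒0<n∸m m<n) (∸-monoʳ-< (s≤s z≤n) (<⇒≤ m<n)) ⟩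
    n ∸ (n ∸ m)          ≡⟨ m∸[m∸n]≡n (<⇒≤ m<n) ⟩
    m                    ≡⟨ m<n⇒m%n≡m m<n ⟨
    m % n                ∎
    where open ≡-Reasoning

[m+n]%o≡n⇒m≡0 : ∀ {m n o} .{{_ : NonZero o}} → m < o → (m ℕ.+ n) % o ≡ n → m ≡ 0
[m+n]%o≡n⇒m≡0 {m} {n} {o} m<o eq = begin
  m         ≡⟨ m<n⇒m%n≡m m<o ⟨
  m % o     ≡⟨ cong (_% o) m≡k*o ⟩
  k * o % o ≡⟨ m*n%n≡0 k o ⟩
  0         ∎
  where
  open ≡-Reasoning
  k = (m ℕ.+ n) / o
  m≡k*o : m ≡ k * o
  m≡k*o = +-cancelʳ-≡ n m (k * o) (begin
    m ℕ.+ n                     ≡⟨ m≡m%n+[m/n]*n (m ℕ.+ n) o ⟩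
    (m ℕ.+ n) % o ℕ.+ k * o     ≡⟨ cong (ℕ._+ k * o) eq ⟩
    n ℕ.+ k * o                 ≡⟨ ℕ.+-comm n (k * o) ⟩
    k * o ℕ.+ n                 ∎)

xor-identityˡ-unique : ∀ x y → x xor y ≡ y → x ≡ false
xor-identityˡ-unique false _     _  = refl
xor-identityˡ-unique true  false ()
xor-identityˡ-unique true  true  ()

y-xor-[x-xor-y]≡x : ∀ x y → y xor (x xor y) ≡ x
y-xor-[x-xor-y]≡x false false = refl
y-xor-[x-xor-y]≡x false true  = refl
y-xor-[x-xor-y]≡x true  false = refl
y-xor-[x-xor-y]≡x true  true  = refl

fromBits : Bool → Bool → ℕ
fromBits false false = 0
fromBits true  false = 1
fromBits false true  = 2
fromBits true  true  = 3

fromBits<4 : ∀ u v → fromBits u v < 4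
fromBits<4 false false = s≤s z≤n
fromBits<4 true  false = s≤s (s≤s z≤n)
fromBits<4 false true  = s≤s (s≤s (s≤s z≤n))
fromBits<4 true  true  = ℕ.≤-refl

_≈ᴳ_ : G → G → Set
(m , a , b) ≈ᴳ (m' , a' , b') = m ≡ m' × a ≡ a' × b ≡ b'

-- Exactly the decision taken inside δ, so that δ reduces along it.
_≟ᴳ_ : (h h' : G) → Dec (h ≈ᴳ h')
(m , a , b) ≟ᴳ (m' , a' , b') = (m ℕ.≟ m') ×-dec ((a ≟ᵇ a') ×-dec (b ≟ᵇ b'))

ε : G
ε = (0 , false , false)

module _ (t : ℕ) .{{_ : NonZero t}} where

  δ-self : ∀ i → δ t i (g t i) ≡ -1ℤ
  δ-self i = cong (if_then -1ℤ else 1ℤ) (dec-true (g t i ≟ᴳ g t i) (refl , refl , refl))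

  δ-other : ∀ i h → h ≢ g t i → δ t i h ≡ 1ℤ
  δ-other i h@(m , a , b) h≢gᵢ =
    cong (if_then -1ℤ else 1ℤ) (dec-false (h ≟ᴳ g t i) λ { (refl , refl , refl) → h≢gᵢ refl })

  ·-identityˡ-unique : ∀ h h' → proj₁ h < t → _·_ t h h' ≡ h' → h ≡ ε
  ·-identityˡ-unique (m , a , b) (m' , a' , b') m<t hh'≡h' =
    cong₂ _,_ ([m+n]%o≡n⇒m≡0 m<t (cong proj₁ hh'≡h'))
      (cong₂ _,_ (xor-identityˡ-unique a a' (cong (proj₁ ∘ proj₂) hh'≡h'))
                 (xor-identityˡ-unique b b' (cong (proj₂ ∘ proj₂) hh'≡h')))

  N-common-column : ∀ i n c → g t n ≢ ε → _·_ t (g t n) (g t c) ≡ g t i →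
    N t i n c ≡ -1ℤ × N t c n c ≡ -1ℤ
  N-common-column i n c gₙ≢ε gₙgc≡gᵢ =
    cong₂ ℤ._*_ (δ-other i (g t c) gc≢gᵢ) (trans (cong (δ t i) gₙgc≡gᵢ) (δ-self i)) ,
    cong₂ ℤ._*_ (δ-self c) (trans (cong (δ t c) gₙgc≡gᵢ) (δ-other c (g t i) (gc≢gᵢ ∘ sym)))
    where
    gc≢gᵢ : g t c ≢ g t i
    gc≢gᵢ gc≡gᵢ = gₙ≢ε (·-identityˡ-unique (g t n) (g t c) (m%n<n _ t)
                          (trans gₙgc≡gᵢ (sym gc≡gᵢ)))

  _⊕_ : ℕ → ℕ → ℕ
  p ⊕ q = fromBits (bitU t p xor bitU t q) (bitV t p xor bitV t q)

  bitU-fromBits : ∀ u v → bitU t (fromBits u v) ≡ u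
  bitU-fromBits false false = refl
  bitU-fromBits true  false = refl
  bitU-fromBits false true  = refl
  bitU-fromBits true  true  = refl

  bitV-fromBits : ∀ u v → bitV t (fromBits u v) ≡ v
  bitV-fromBits false false = refl
  bitV-fromBits true  false = refl
  bitV-fromBits false true  = refl
  bitV-fromBits true  true  = refl

  bits-false⇒0 : ∀ r → r < 4 → bitU t r ≡ false → bitV t r ≡ false → r ≡ 0
  bits-false⇒0 0 _ _ _ = refl
  bits-false⇒0 1 _ () _
  bits-false⇒0 2 _ _ ()
  bits-false⇒0 3 _ () _
  bits-false⇒0 (suc (suc (suc (suc _)))) (s≤s (s≤s (s≤s (s≤s ())))) _ _

  g-digits : ∀ r c → r < 4 → g t (suc (r ℕ.+ c * 4)) ≡ (c % t , bitU t r , bitV t r)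
  g-digits r c r<4 = cong₂ (λ x y → (x % t , bitU t y , bitV t y)) quotient residue
    where
    quotient : (r ℕ.+ c * 4) / 4 ≡ c
    quotient = trans (+-distrib-/-∣ʳ r (divides-refl c)) (cong₂ ℕ._+_ (m<n⇒m/n≡0 r<4) (m*n/n≡m c 4))
    residue : (r ℕ.+ c * 4) % 4 ≡ r
    residue = trans ([m+kn]%n≡m%n r c 4) (m<n⇒m%n≡m r<4)

  g≢ε : ∀ n → 2 ≤ n → n ≤ 4 * t → g t n ≢ ε
  g≢ε (suc n) (s≤s 1≤n) n<4t gₙ≡ε = ℕ.<⇒≢ 1≤n (sym (begin
    n                   ≡⟨ m≡m%n+[m/n]*n n 4 ⟩
    n % 4 ℕ.+ n / 4 * 4 ≡⟨ cong₂ (λ r c → r ℕ.+ c * 4) residue≡0 quotient≡0 ⟩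
    0                   ∎))
    where
    open ≡-Reasoning
    quotient<t : n / 4 < t
    quotient<t = m<n*o⇒m/o<n (subst (n <_) (ℕ.*-comm 4 t) n<4t)
    residue≡0 : n % 4 ≡ 0
    residue≡0 = bits-false⇒0 (n % 4) (m%n<n n 4) (cong (proj₁ ∘ proj₂) gₙ≡ε) (cong (proj₂ ∘ proj₂) gₙ≡ε)
    quotient≡0 : n / 4 ≡ 0
    quotient≡0 = trans (sym (m<n⇒m%n≡m quotient<t)) (cong proj₁ gₙ≡ε)

  sgn-periodic : ∀ x k → sgn t (x ℕ.+ k * 2) ≡ sgn t x
  sgn-periodic x k = begin
    -1ℤ ℤ.^ (x ℕ.+ k * 2)           ≡⟨ ^-distribˡ-+-* -1ℤ x (k * 2) ⟩
    sgn t x ℤ.* -1ℤ ℤ.^ (k * 2)     ≡⟨ cong (λ m → sgn t x ℤ.* -1ℤ ℤ.^ m) (ℕ.*-comm k 2) ⟩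
    sgn t x ℤ.* -1ℤ ℤ.^ (2 * k)     ≡⟨ cong (sgn t x ℤ.*_) (^-*-assoc -1ℤ 2 k) ⟨
    sgn t x ℤ.* 1ℤ ℤ.^ k            ≡⟨ cong (sgn t x ℤ.*_) (^-zeroˡ k) ⟩
    sgn t x ℤ.* 1ℤ                  ≡⟨ ℤ.*-identityʳ (sgn t x) ⟩
    sgn t x                         ∎
    where open ≡-Reasoning

  offset : ℕ → ℤ → ℕ → ℤ
  offset 1 s r = + 1
  offset 2 s r = + 2 ℤ.- s
  offset 3 s r = + 3 ℤ.- + 2 ℤ.* sgn t ((r ℕ.+ 1) / 2)
  offset _ s r = + 4 ℤ.+ s ℤ.* (+ 1 ℤ.- + 4 ℤ.* (+ 1 ℤ.- + (r / 2)))

  jRawCase≡+offset : ∀ k i n → jRawCase t k i n ≡ + i ℤ.- + n ℤ.+ offset k (sgn t i) (i % 4)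
  jRawCase≡+offset 0 i n = ℤ.+-assoc (+ i ℤ.- + n) (+ 4) _
  jRawCase≡+offset 1 i n = refl
  jRawCase≡+offset 2 i n = ℤ.+-assoc (+ i ℤ.- + n) (+ 2) _
  jRawCase≡+offset 3 i n = ℤ.+-assoc (+ i ℤ.- + n) (+ 3) _
  jRawCase≡+offset (suc (suc (suc (suc _)))) i n = ℤ.+-assoc (+ i ℤ.- + n) (+ 4) _

  jRawCase-periodic : ∀ k i n a b →
    jRawCase t k (i ℕ.+ a * 4) (n ℕ.+ b * 4) ≡ jRawCase t k i n ℤ.+ (+ (a * 4) ℤ.- + (b * 4))
  jRawCase-periodic k i n a b = begin
    jRawCase t k (i ℕ.+ a * 4) (n ℕ.+ b * 4)
      ≡⟨ jRawCase≡+offset k _ _ ⟩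
    + (i ℕ.+ a * 4) ℤ.- + (n ℕ.+ b * 4) ℤ.+ offset k (sgn t (i ℕ.+ a * 4)) ((i ℕ.+ a * 4) % 4)
      ≡⟨ cong₂ (λ x y → x ℤ.- y ℤ.+ offset k (sgn t (i ℕ.+ a * 4)) ((i ℕ.+ a * 4) % 4))
               (pos-+ i (a * 4)) (pos-+ n (b * 4)) ⟩
    (+ i ℤ.+ + (a * 4)) ℤ.- (+ n ℤ.+ + (b * 4)) ℤ.+ offset k (sgn t (i ℕ.+ a * 4)) ((i ℕ.+ a * 4) % 4)
      ≡⟨ cong (λ o → (+ i ℤ.+ + (a * 4)) ℤ.- (+ n ℤ.+ + (b * 4)) ℤ.+ o) (cong₂ (offset k) sign residue) ⟩
    (+ i ℤ.+ + (a * 4)) ℤ.- (+ n ℤ.+ + (b * 4)) ℤ.+ offset k (sgn t i) (i % 4)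
      ≡⟨ regroup (+ i) (+ n) (+ (a * 4)) (+ (b * 4)) (offset k (sgn t i) (i % 4)) ⟩
    + i ℤ.- + n ℤ.+ offset k (sgn t i) (i % 4) ℤ.+ (+ (a * 4) ℤ.- + (b * 4))
      ≡⟨ cong (ℤ._+ (+ (a * 4) ℤ.- + (b * 4))) (jRawCase≡+offset k i n) ⟨
    jRawCase t k i n ℤ.+ (+ (a * 4) ℤ.- + (b * 4))
      ∎
    where
    open ≡-Reasoning
    sign : sgn t (i ℕ.+ a * 4) ≡ sgn t i
    sign = trans (cong (λ m → sgn t (i ℕ.+ m)) (sym (ℕ.*-assoc a 2 2))) (sgn-periodic i (a * 2))
    residue : (i ℕ.+ a * 4) % 4 ≡ i % 4
    residue = [m+kn]%n≡m%n i a 4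
    regroup : ∀ I N A B K → (I ℤ.+ A) ℤ.- (N ℤ.+ B) ℤ.+ K ≡ I ℤ.- N ℤ.+ K ℤ.+ (A ℤ.- B)
    regroup = solve-∀

  jRawCase-first-block : ∀ p q → p < 4 → q < 4 → jRawCase t (suc q % 4) (suc p) (suc q) ≡ + suc (p ⊕ q)
  jRawCase-first-block 0 0 _ _ = refl
  jRawCase-first-block 0 1 _ _ = refl
  jRawCase-first-block 0 2 _ _ = refl
  jRawCase-first-block 0 3 _ _ = refl
  jRawCase-first-block 1 0 _ _ = refl
  jRawCase-first-block 1 1 _ _ = refl
  jRawCase-first-block 1 2 _ _ = refl
  jRawCase-first-block 1 3 _ _ = refl
  jRawCase-first-block 2 0 _ _ = refl
  jRawCase-first-block 2 1 _ _ = refl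
  jRawCase-first-block 2 2 _ _ = refl
  jRawCase-first-block 2 3 _ _ = refl
  jRawCase-first-block 3 0 _ _ = refl
  jRawCase-first-block 3 1 _ _ = refl
  jRawCase-first-block 3 2 _ _ = refl
  jRawCase-first-block 3 3 _ _ = refl
  jRawCase-first-block (suc (suc (suc (suc _)))) _ (s≤s (s≤s (s≤s (s≤s ())))) _
  jRawCase-first-block _ (suc (suc (suc (suc _)))) _ (s≤s (s≤s (s≤s (s≤s ()))))

  -- (a − b) mod t; meaningful for b ≤ t, as ∸ truncates
  _⊖ₜ_ : ℕ → ℕ → ℕ
  a ⊖ₜ b = (a ℕ.+ (t ∸ b)) % t

  [b+[a⊖ₜb]]%t≡a%t : ∀ a b → b ≤ t → (b % t ℕ.+ (a ⊖ₜ b) % t) % t ≡ a % t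
  [b+[a⊖ₜb]]%t≡a%t a b b≤t = begin
    (b % t ℕ.+ (a ⊖ₜ b) % t) % t              ≡⟨ cong (λ x → (b % t ℕ.+ x) % t) (m%n%n≡m%n _ t) ⟩
    (b % t ℕ.+ (a ℕ.+ (t ∸ b)) % t) % t       ≡⟨ %-distribˡ-+ b _ t ⟨
    (b ℕ.+ (a ℕ.+ (t ∸ b))) % t               ≡⟨ cong (_% t) (ℕ.+-comm b _) ⟩
    (a ℕ.+ (t ∸ b) ℕ.+ b) % t                 ≡⟨ cong (_% t) (ℕ.+-assoc a _ b) ⟩
    (a ℕ.+ ((t ∸ b) ℕ.+ b)) % t               ≡⟨ cong (λ x → (a ℕ.+ x) % t) (m∸n+n≡m b≤t) ⟩
    (a ℕ.+ t) % t                             ≡⟨ [m+n]%n≡m%n a t ⟩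
    a % t                                     ∎
    where open ≡-Reasoning

  digit-difference-%ℕ : ∀ d .{{_ : NonZero d}} .{{_ : NonZero (d * t)}} r a b → r < d → b ≤ t →
    (+ r ℤ.+ (+ (a * d) ℤ.- + (b * d))) %ℕ (d * t) ≡ r ℕ.+ (a ⊖ₜ b) * d
  digit-difference-%ℕ d r a b r<d b≤t = begin
    (+ r ℤ.+ (+ (a * d) ℤ.- + (b * d))) %ℕ (d * t) ≡⟨ cong (_%ℕ (d * t)) as-difference ⟩
    (+ X ℤ.- + (d * t)) %ℕ (d * t)                  ≡⟨ [m-n]%ℕn≡m%n X (d * t) ⟩
    X % (d * t)                                     ≡⟨ %-congʳ (ℕ.*-comm d t) ⟩
    (r ℕ.+ c * d) % (t * d)                         ≡⟨ cong (_% (t * d)) (ℕ.+-comm r (c * d)) ⟩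
    (c * d ℕ.+ r) % (t * d)                         ≡⟨ [m*n+o]%[p*n]≡[m*n]%[p*n]+o c t r<d ⟩
    c * d % (t * d) ℕ.+ r                           ≡⟨ cong (ℕ._+ r) (m%n*o≡m*o%[n*o] c t d) ⟨
    c % t * d ℕ.+ r                                 ≡⟨ ℕ.+-comm (c % t * d) r ⟩
    r ℕ.+ (a ⊖ₜ b) * d                              ∎
    where
    open ≡-Reasoning
    instance
      t*d≢0 : NonZero (t * d)
      t*d≢0 = m*n≢0 t d
    s = t ∸ b
    c = a ℕ.+ s
    X = r ℕ.+ c * d
    expand-X : ∀ r a s d → r ℕ.+ (a ℕ.+ s) * d ≡ r ℕ.+ a * d ℕ.+ s * d
    expand-X = ℕ-Ring.solve-∀
    expand-d*t : ∀ b s d → d * (b ℕ.+ s) ≡ b * d ℕ.+ s * d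
    expand-d*t = ℕ-Ring.solve-∀
    cancel-S : ∀ R A B S → R ℤ.+ A ℤ.+ S ℤ.- (B ℤ.+ S) ≡ R ℤ.+ (A ℤ.- B)
    cancel-S = solve-∀
    as-difference : + r ℤ.+ (+ (a * d) ℤ.- + (b * d)) ≡ + X ℤ.- + (d * t)
    as-difference = sym (begin
      + X ℤ.- + (d * t)
        ≡⟨ cong₂ (λ x y → + x ℤ.- + y) (expand-X r a s d)
                 (trans (cong (d *_) (sym (m+[n∸m]≡n b≤t))) (expand-d*t b s d)) ⟩
      + (r ℕ.+ a * d ℕ.+ s * d) ℤ.- + (b * d ℕ.+ s * d)
        ≡⟨ cong₂ ℤ._-_ (trans (pos-+ _ (s * d)) (cong (ℤ._+ + (s * d)) (pos-+ r (a * d))))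
                       (pos-+ (b * d) (s * d)) ⟩
      + r ℤ.+ + (a * d) ℤ.+ + (s * d) ℤ.- (+ (b * d) ℤ.+ + (s * d))
        ≡⟨ cancel-S (+ r) (+ (a * d)) (+ (b * d)) (+ (s * d)) ⟩
      + r ℤ.+ (+ (a * d) ℤ.- + (b * d))
        ∎)

  instance
    4*t≢0 : NonZero (4 * t)
    4*t≢0 = m*n≢0 4 t

  jIdx≤4t : ∀ i n → jIdx t i n ≤ 4 * t
  jIdx≤4t i n = n%ℕd<d (jRawCase t (n % 4) i n ℤ.- 1ℤ) (4 * t)

  jIdx-digits : ∀ p q a b → p < 4 → q < 4 → b ≤ t →
    jIdx t (suc (p ℕ.+ a * 4)) (suc (q ℕ.+ b * 4)) ≡ suc (p ⊕ q ℕ.+ (a ⊖ₜ b) * 4)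
  jIdx-digits p q a b p<4 q<4 b≤t = cong suc (begin
    (jRawCase t (suc (q ℕ.+ b * 4) % 4) (suc p ℕ.+ a * 4) (suc q ℕ.+ b * 4) ℤ.- 1ℤ) %ℕ (4 * t)
      ≡⟨ cong (λ z → (z ℤ.- 1ℤ) %ℕ (4 * t)) raw ⟩
    (+ suc (p ⊕ q) ℤ.+ Δ ℤ.- 1ℤ) %ℕ (4 * t)
      ≡⟨ cong (_%ℕ (4 * t)) (trans (cong (λ x → x ℤ.+ Δ ℤ.- 1ℤ) (pos-+ 1 (p ⊕ q))) (drop-one (+ (p ⊕ q)) Δ)) ⟩
    (+ (p ⊕ q) ℤ.+ Δ) %ℕ (4 * t)
      ≡⟨ digit-difference-%ℕ 4 (p ⊕ q) a b (fromBits<4 _ _) b≤t ⟩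
    p ⊕ q ℕ.+ (a ⊖ₜ b) * 4
      ∎)
    where
    open ≡-Reasoning
    Δ = + (a * 4) ℤ.- + (b * 4)
    drop-one : ∀ R D → + 1 ℤ.+ R ℤ.+ D ℤ.- + 1 ≡ R ℤ.+ D
    drop-one = solve-∀
    raw : jRawCase t (suc (q ℕ.+ b * 4) % 4) (suc p ℕ.+ a * 4) (suc q ℕ.+ b * 4) ≡ + suc (p ⊕ q) ℤ.+ Δ
    raw = begin
      jRawCase t (suc (q ℕ.+ b * 4) % 4) (suc p ℕ.+ a * 4) (suc q ℕ.+ b * 4)
        ≡⟨ cong (λ k → jRawCase t k (suc p ℕ.+ a * 4) (suc q ℕ.+ b * 4)) ([m+kn]%n≡m%n (suc q) b 4) ⟩
      jRawCase t (suc q % 4) (suc p ℕ.+ a * 4) (suc q ℕ.+ b * 4)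
        ≡⟨ jRawCase-periodic (suc q % 4) (suc p) (suc q) a b ⟩
      jRawCase t (suc q % 4) (suc p) (suc q) ℤ.+ Δ
        ≡⟨ cong (ℤ._+ Δ) (jRawCase-first-block p q p<4 q<4) ⟩
      + suc (p ⊕ q) ℤ.+ Δ
        ∎

  ·-jIdx-digits : ∀ p q a b → p < 4 → q < 4 → b < t →
    let i = suc (p ℕ.+ a * 4); n = suc (q ℕ.+ b * 4) in
    _·_ t (g t n) (g t (jIdx t i n)) ≡ g t i
  ·-jIdx-digits p q a b p<4 q<4 b<t = begin
    _·_ t (g t (suc (q ℕ.+ b * 4))) (g t (jIdx t (suc (p ℕ.+ a * 4)) (suc (q ℕ.+ b * 4))))
      ≡⟨ cong (λ j → _·_ t (g t (suc (q ℕ.+ b * 4))) (g t j)) (jIdx-digits p q a b p<4 q<4 (<⇒≤ b<t)) ⟩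
    _·_ t (g t (suc (q ℕ.+ b * 4))) (g t (suc (p ⊕ q ℕ.+ (a ⊖ₜ b) * 4)))
      ≡⟨ cong₂ (_·_ t) (g-digits q b q<4) (g-digits (p ⊕ q) (a ⊖ₜ b) (fromBits<4 _ _)) ⟩
    _·_ t (b % t , bitU t q , bitV t q) ((a ⊖ₜ b) % t , bitU t (p ⊕ q) , bitV t (p ⊕ q))
      ≡⟨ cong₂ _,_ ([b+[a⊖ₜb]]%t≡a%t a b (<⇒≤ b<t))
           (cong₂ _,_ (trans (cong (bitU t q xor_) (bitU-fromBits _ _)) (y-xor-[x-xor-y]≡x (bitU t p) (bitU t q)))
                      (trans (cong (bitV t q xor_) (bitV-fromBits _ _)) (y-xor-[x-xor-y]≡x (bitV t p) (bitV t q)))) ⟩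
    (a % t , bitU t p , bitV t p)
      ≡⟨ g-digits p a p<4 ⟨
    g t (suc (p ℕ.+ a * 4))
      ∎
    where open ≡-Reasoning

  ·-jIdx : ∀ i n → suc n ≤ 4 * t → _·_ t (g t (suc n)) (g t (jIdx t (suc i) (suc n))) ≡ g t (suc i)
  ·-jIdx i n n<4t =
    subst₂ (λ i' n' → _·_ t (g t (suc n')) (g t (jIdx t (suc i') (suc n'))) ≡ g t (suc i'))
      (sym (m≡m%n+[m/n]*n i 4)) (sym (m≡m%n+[m/n]*n n 4))
      (·-jIdx-digits (i % 4) (n % 4) (i / 4) (n / 4) (m%n<n i 4) (m%n<n n 4)
        (m<n*o⇒m/o<n (subst (n <_) (ℕ.*-comm 4 t) n<4t)))

lemma1 : (t : ℕ) .{{_ : NonZero t}} → 1 < t → t % 2 ≡ 1 →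
    (i n : ℕ) → 1 ≤ i → i ≤ 4 * t → 2 ≤ n → n ≤ 4 * t →
    ∃[ c ] (1 ≤ c × c ≤ 4 * t × N t i n c ≡ -1ℤ × N t (jIdx t i n) n c ≡ -1ℤ)
lemma1 t _ _ (suc i) (suc n) _ _ 2≤n n≤4t =
  jIdx t (suc i) (suc n) , s≤s z≤n , jIdx≤4t t (suc i) (suc n) ,
  N-common-column t (suc i) (suc n) (jIdx t (suc i) (suc n)) (g≢ε t (suc n) 2≤n n≤4t) (·-jIdx t i n n≤4t)
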